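{- Let $F$ be a CNF formula in which the variable $x$ does not occur, and let $c$ and $c_1 \vee c_2$ be two different clauses of $F$ ($c_1, c_2$ clauses). If $c$ is superredundant in $(F \setminus \{c_1 \vee c_2\}) \cup \{c_1 \vee x,\ c_2 \vee \neg x\}$, then either $c$ resolves with both $c_1$ and $c_2$, or $c$ is superredundant in $F$.
   Context: A CNF formula is a finite set of clauses; a clause is a finite set of literals, read as their disjunction. Tautological clauses are not allowed. Resolution: from clauses $d_1 \vee l$ and $d_2 \vee \neg l$ derive $d_1 \vee d_2$; two clauses resolve if they can be written in this form with a non-tautological resolvent (clauses whose resolvent would be a tautology are considered not to resolve). The resolution closure $\mathrm{ResCn}(F)$ is the set of all clauses obtainable from $F$ by zero or more resolution steps. A clause $c \in F$ is superredundant in $F$ if $\mathrm{ResCn}(F) \setminus \{c\} \models c$. -}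

module Defs where

open import Data.Nat using (ℕ)
open import Data.Bool using (Bool; true; false; not)
open import Data.List using (List; _∷_; _++_)
open import Data.List.Relation.Unary.Any using (Any)
open import Data.List.Membership.Propositional using (_∈_)
open import Data.Product using (Σ; _×_)
open import Data.Sum using (_⊎_)
open import Relation.Nullary using (¬_)
open import Relation.Binary.PropositionalEquality using (_≡_; _≢_)

Var : Set
Var = ℕ

data Lit : Set where
  pos : Var → Lit
  neg : Var → Lit

comp : Lit → Lit
comp (pos v) = neg v
comp (neg v) = pos v

-- A clause is a finite set of literals, represented by a list;
-- two lists denote the same clause iff they have the same members.
Clause : Set
Clause = List Lit

_≈_ : Clause → Clause → Set
c ≈ d = ∀ l → ((l ∈ c → l ∈ d) × (l ∈ d → l ∈ c))

Taut : Clause → Set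
Taut c = Σ Var (λ v → (pos v ∈ c) × (neg v ∈ c))

-- A CNF formula, in general given as a (≈-closed) predicate on clauses.
Formula : Set₁
Formula = Clause → Set

_∈F_ : Clause → List Clause → Set
d ∈F F = Any (λ e → d ≈ e) F

toFormula : List Clause → Formula
toFormula F d = d ∈F F

Resolvent : Clause → Clause → Clause → Set
Resolvent c1 c2 r =
  Σ Lit (λ l → (l ∈ c1) × (comp l ∈ c2) × (¬ Taut r) ×
    (∀ m → ((m ∈ r → ((m ∈ c1 × m ≢ l) ⊎ (m ∈ c2 × m ≢ comp l)))
          × (((m ∈ c1 × m ≢ l) ⊎ (m ∈ c2 × m ≢ comp l)) → m ∈ r))))

Resolve : Clause → Clause → Set
Resolve c1 c2 = Σ Clause (λ r → Resolvent c1 c2 r)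

data ResCn (F : Formula) : Clause → Set where
  base : ∀ {d} → F d → ResCn F d
  res  : ∀ {a b r} → ResCn F a → ResCn F b → Resolvent a b r → ResCn F r

Assignment : Set
Assignment = Var → Bool

SatLit : Assignment → Lit → Set
SatLit α (pos v) = α v ≡ true
SatLit α (neg v) = α v ≡ false

Sat : Assignment → Clause → Set
Sat α c = Any (SatLit α) c

_⊨_ : Formula → Clause → Set
S ⊨ c = ∀ (α : Assignment) → (∀ d → S d → Sat α d) → Sat α c

Superredundant : Formula → Clause → Set
Superredundant F c = (λ d → ResCn F d × ¬ (d ≈ c)) ⊨ c

NotOccurs : Var → Clause → Set
NotOccurs x d = (¬ (pos x ∈ d)) × (¬ (neg x ∈ d))

split : List Clause → Var → Clause → Clause → Formula
split F x c1 c2 d =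
  ((d ∈F F) × ¬ (d ≈ (c1 ++ c2))) ⊎ ((d ≈ (pos x ∷ c1)) ⊎ (d ≈ (neg x ∷ c2)))

{-# OPTIONS --safe #-}
-- Suppose α satisfies ResCn F ∖ {c} but falsifies c, and write α [ l ] for α with the literal
-- l made true. Each clause e of ResCn F is satisfied by every flip α [ l ] with l ∈ c: otherwise
-- comp l ∈ e, and the resolvent of c and e upon l would be a clause of ResCn F ∖ {c} falsified
-- by α. Being satisfied by α (unless equal to c) and by all these flips is preserved by
-- resolution, so it passes from a formula to its resolution closure. If c does not resolve with
-- c1, this property can be arranged for x ∨ c1 and ¬x ∨ c2 by choosing the value of x: when α
-- satisfies c1, make ¬x true (the flips still satisfy c1, as c does not resolve with c1);
-- otherwise α and its flips satisfy c2, and make x true. Then the new assignment satisfies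
-- ResCn(split) ∖ {c}, so by superredundancy it satisfies c, hence so does α since x ∉ c.
module Submission where

open import Defs
open import Data.Nat using (_≟_)
open import Data.Bool using (Bool; true; false)
open import Data.Bool.Properties using () renaming (_≟_ to _≟ᵇ_)
open import Data.List using (List; _∷_; _++_; filter)
open import Data.List.Relation.Unary.Any using (here; there; any?)
open import Data.List.Relation.Unary.Any.Properties using (++⁻; ++⁺ˡ; ++⁺ʳ; ++-comm)
open import Data.List.Membership.Propositional using (_∈_; _∉_; find; lose)
open import Data.List.Membership.Propositional.Properties using (∈-filter⁺; ∈-filter⁻)
open import Data.List.Relation.Binary.Subset.Propositional using (_⊆_)
open import Data.List.Relation.Binary.Subset.Propositional.Properties
  using (Any-resp-⊆; xs⊆x∷xs; xs⊆xs++ys; xs⊆ys++xs)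
open import Data.Product using (Σ; _×_; _,_; proj₁; proj₂)
open import Data.Sum as Sum using (_⊎_; inj₁; inj₂; [_,_])
open import Data.Empty using (⊥; ⊥-elim)
open import Function using (_∘_; id)
open import Relation.Nullary using (¬_; Dec; yes; no)
open import Relation.Nullary.Decidable using (map′; ¬?; _×-dec_)
open import Relation.Binary.Definitions using (DecidableEquality)
open import Relation.Binary.PropositionalEquality using (_≡_; _≢_; refl; sym; trans; cong; subst)

private
  variable
    x : Var
    k l : Lit
    a b c d e p q r : Clause
    α β γ : Assignment
    H : Formula

_≟ₗ_ : DecidableEquality Lit
pos v ≟ₗ pos w = map′ (cong pos) (λ { refl → refl }) (v ≟ w)
neg v ≟ₗ neg w = map′ (cong neg) (λ { refl → refl }) (v ≟ w)
pos _ ≟ₗ neg _ = no λ ()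
neg _ ≟ₗ pos _ = no λ ()

open import Data.List.Membership.DecPropositional _≟ₗ_ using (_∈?_)

var : Lit → Var
var (pos v) = v
var (neg v) = v

sign : Lit → Bool
sign (pos _) = true
sign (neg _) = false

comp-involutive : ∀ l → comp (comp l) ≡ l
comp-involutive (pos _) = refl
comp-involutive (neg _) = refl

var-≡ : ∀ k l → var k ≡ var l → k ≡ l ⊎ k ≡ comp l
var-≡ (pos _) (pos _) refl = inj₁ refl
var-≡ (pos _) (neg _) refl = inj₂ refl
var-≡ (neg _) (pos _) refl = inj₂ refl
var-≡ (neg _) (neg _) refl = inj₁ refl

var-≢ : k ≢ l → k ≢ comp l → var k ≢ var l
var-≢ {k = k} {l = l} k≢l k≢l̄ = [ k≢l , k≢l̄ ] ∘ var-≡ k l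

clash→taut : k ∈ e → comp k ∈ e → Taut e
clash→taut {pos v} k∈e k̄∈e = v , k∈e , k̄∈e
clash→taut {neg v} k∈e k̄∈e = v , k̄∈e , k∈e

taut? : (e : Clause) → Dec (Taut e)
taut? e with any? (λ k → comp k ∈? e) e
... | yes clash = let _ , k∈e , k̄∈e = find clash in yes (clash→taut k∈e k̄∈e)
... | no ¬clash = no λ { (_ , p∈e , n∈e) → ¬clash (lose p∈e n∈e) }

¬Taut-⊆ : d ⊆ e → ¬ Taut e → ¬ Taut d
¬Taut-⊆ d⊆e ¬te (v , p∈d , n∈d) = ¬te (v , d⊆e p∈d , d⊆e n∈d)

¬Taut-∷ : NotOccurs (var k) e → ¬ Taut e → ¬ Taut (k ∷ e)
¬Taut-∷ _ _ (_ , here refl , here ())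
¬Taut-∷ (_ , n∉e) _ (_ , here refl , there n∈e) = n∉e n∈e
¬Taut-∷ (p∉e , _) _ (_ , there p∈e , here refl) = p∉e p∈e
¬Taut-∷ _ ¬te (v , there p∈e , there n∈e) = ¬te (v , p∈e , n∈e)

NotOccurs-⊆ : d ⊆ e → NotOccurs x e → NotOccurs x d
NotOccurs-⊆ d⊆e (p∉e , n∉e) = p∉e ∘ d⊆e , n∉e ∘ d⊆e

NotOccurs-var : NotOccurs x e → k ∈ e → var k ≢ x
NotOccurs-var {k = pos _} (p∉e , _) k∈e refl = p∉e k∈e
NotOccurs-var {k = neg _} (_ , n∉e) k∈e refl = n∉e k∈e

≈⇒⊆ : d ≈ e → d ⊆ e
≈⇒⊆ d≈e = proj₁ (d≈e _)

≈⇒⊇ : d ≈ e → e ⊆ d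
≈⇒⊇ d≈e = proj₂ (d≈e _)

≈-sym : d ≈ e → e ≈ d
≈-sym d≈e k = proj₂ (d≈e k) , proj₁ (d≈e k)

¬¬≈⇒⊆ : ¬ ¬ (d ≈ e) → d ⊆ e
¬¬≈⇒⊆ {e = e} ¬d≉e {k} k∈d with k ∈? e
... | yes k∈e = k∈e
... | no k∉e = ⊥-elim (¬d≉e λ d≈e → k∉e (≈⇒⊆ d≈e k∈d))

SatLit-agree : β (var k) ≡ γ (var k) → SatLit γ k → SatLit β k
SatLit-agree {k = pos _} = trans
SatLit-agree {k = neg _} = trans

SatLit-comp : SatLit α l → ¬ SatLit α (comp l)
SatLit-comp {l = pos _} s s̄ with () ← trans (sym s) s̄
SatLit-comp {l = neg _} s s̄ with () ← trans (sym s̄) s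

satLit? : ∀ α l → Dec (SatLit α l)
satLit? α (pos v) = α v ≟ᵇ true
satLit? α (neg v) = α v ≟ᵇ false

sat? : ∀ α e → Dec (Sat α e)
sat? α = any? (satLit? α)

Taut⇒Sat : Taut e → Sat α e
Taut⇒Sat {α = α} (v , p∈e , n∈e) with α v in αv
... | true = lose p∈e αv
... | false = lose n∈e αv

_[_] : Assignment → Lit → Assignment
(α [ l ]) v with v ≟ var l
... | yes _ = sign l
... | no _ = α v

AgreeOff : Var → Assignment → Assignment → Set
AgreeOff x β γ = ∀ v → v ≢ x → β v ≡ γ v

update-agreeOff : var l ≡ x → AgreeOff x (α [ l ]) α
update-agreeOff {l = l} refl v v≢l with v ≟ var l
... | yes v≡l = ⊥-elim (v≢l v≡l)
... | no _ = refl

AgreeOff-update : AgreeOff x β γ → AgreeOff x (β [ l ]) (γ [ l ])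
AgreeOff-update {l = l} ag v v≢x with v ≟ var l
... | yes _ = refl
... | no _ = ag v v≢x

AgreeOff-sym : AgreeOff x β γ → AgreeOff x γ β
AgreeOff-sym ag v v≢x = sym (ag v v≢x)

Sat-agreeOff : AgreeOff x β γ → NotOccurs x e → Sat γ e → Sat β e
Sat-agreeOff ag x∉e s =
  let k , k∈e , sk = find s in lose k∈e (SatLit-agree (ag (var k) (NotOccurs-var x∉e k∈e)) sk)

update-var : (α [ l ]) (var l) ≡ sign l
update-var {l = l} with var l ≟ var l
... | yes _ = refl
... | no v≢v = ⊥-elim (v≢v refl)

update-sat : SatLit (α [ l ]) l
update-sat {α = α} {l = pos v} = update-var {α = α} {l = pos v}
update-sat {α = α} {l = neg v} = update-var {α = α} {l = neg v}

SatLit-update-other : var k ≢ var l → SatLit α k → SatLit (α [ l ]) k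
SatLit-update-other {k = k} vk≢vl = SatLit-agree (update-agreeOff refl (var k) vk≢vl)

SatLit-update-other⁻ : var k ≢ var l → SatLit (α [ l ]) k → SatLit α k
SatLit-update-other⁻ {k = k} vk≢vl = SatLit-agree (sym (update-agreeOff refl (var k) vk≢vl))

SatLit-update⁺ : SatLit α k → k ≢ comp l → SatLit (α [ l ]) k
SatLit-update⁺ {k = k} {l = l} sk k≢l̄ with k ≟ₗ l
... | yes refl = update-sat
... | no k≢l = SatLit-update-other (var-≢ k≢l k≢l̄) sk

SatLit-update⁻ : SatLit (α [ l ]) k → k ≡ l ⊎ SatLit α k
SatLit-update⁻ {l = l} {k = k} sk with k ≟ₗ l | k ≟ₗ comp l
... | yes k≡l | _ = inj₁ k≡l
... | no _ | yes refl = ⊥-elim (SatLit-comp update-sat sk)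
... | no k≢l | no k≢l̄ = inj₂ (SatLit-update-other⁻ (var-≢ k≢l k≢l̄) sk)

Sat-update⁻ : Sat (α [ l ]) e → l ∈ e ⊎ Sat α e
Sat-update⁻ s with find s
... | k , k∈e , sk with SatLit-update⁻ sk
...   | inj₁ refl = inj₁ k∈e
...   | inj₂ sk′ = inj₂ (lose k∈e sk′)

_∖_ : Clause → Lit → Clause
e ∖ l = filter (λ k → ¬? (k ≟ₗ l)) e

resolvent : Clause → Lit → Clause → Clause
resolvent a l b = a ∖ l ++ b ∖ comp l

∈-resolvent⁻ : k ∈ resolvent a l b → (k ∈ a × k ≢ l) ⊎ (k ∈ b × k ≢ comp l)
∈-resolvent⁻ {a = a} {l = l} = Sum.map (∈-filter⁻ _) (∈-filter⁻ _) ∘ ++⁻ (a ∖ l)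

∈-resolvent⁺ : (k ∈ a × k ≢ l) ⊎ (k ∈ b × k ≢ comp l) → k ∈ resolvent a l b
∈-resolvent⁺ {a = a} {l = l} (inj₁ (k∈a , k≢l)) = ++⁺ˡ (∈-filter⁺ _ k∈a k≢l)
∈-resolvent⁺ {a = a} {l = l} (inj₂ (k∈b , k≢l̄)) = ++⁺ʳ (a ∖ l) (∈-filter⁺ _ k∈b k≢l̄)

Resolvent-resolvent : l ∈ a → comp l ∈ b → ¬ Taut (resolvent a l b)
  → Resolvent a b (resolvent a l b)
Resolvent-resolvent {l = l} l∈a l̄∈b ¬t = l , l∈a , l̄∈b , ¬t , λ _ → ∈-resolvent⁻ , ∈-resolvent⁺

resolve? : ∀ a b → Dec (Resolve a b)
resolve? a b with any? (λ l → comp l ∈? b ×-dec ¬? (taut? (resolvent a l b))) a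
... | yes ok = let _ , l∈a , l̄∈b , ¬t = find ok in yes (_ , Resolvent-resolvent l∈a l̄∈b ¬t)
... | no ¬ok = no λ { (_ , _ , l∈a , l̄∈b , ¬tr , spec) →
  ¬ok (lose l∈a (l̄∈b , ¬Taut-⊆ (λ k∈ → proj₂ (spec _) (∈-resolvent⁻ k∈)) ¬tr)) }

Resolvent-sound : Resolvent a b r → Sat α a → Sat α b → Sat α r
Resolvent-sound (m , _ , _ , _ , spec) sa sb with find sa | find sb
... | k , k∈a , sk | n , n∈b , sn with k ≟ₗ m | n ≟ₗ comp m
...   | no k≢m | _ = lose (proj₂ (spec k) (inj₁ (k∈a , k≢m))) sk
...   | yes _ | no n≢m̄ = lose (proj₂ (spec n) (inj₂ (n∈b , n≢m̄))) sn
...   | yes refl | yes refl = ⊥-elim (SatLit-comp sk sn)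

ResCn-¬Taut : (∀ {d} → H d → ¬ Taut d) → ResCn H d → ¬ Taut d
ResCn-¬Taut ¬t (base d∈H) = ¬t d∈H
ResCn-¬Taut _ (res _ _ (_ , _ , _ , ¬tr , _)) = ¬tr

SatFlips : Assignment → Clause → Clause → Set
SatFlips α c e = ∀ {l} → l ∈ c → Sat (α [ l ]) e

FlipInvariant : Assignment → Clause → Clause → Set
FlipInvariant α c e = (¬ e ≈ c → Sat α e) × SatFlips α c e

flip-sat-resolvent : ¬ Taut b → l ∈ b → (∀ {k} → k ∈ b → k ≢ l → k ∈ r)
  → Sat (α [ comp l ]) b → Sat α r
flip-sat-resolvent ¬tb l∈b b∖l⊆r s with find s
... | n , n∈b , sn with SatLit-update⁻ sn
...   | inj₁ refl = ⊥-elim (¬tb (clash→taut l∈b n∈b))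
...   | inj₂ sn′ = lose (b∖l⊆r n∈b λ { refl → SatLit-comp sn update-sat }) sn′

FlipInvariant-resolvent : ¬ Taut a → ¬ Taut b → FlipInvariant α c a → FlipInvariant α c b
  → Resolvent a b r → FlipInvariant α c r
FlipInvariant-resolvent {a = a} {b = b} {α = α} {c = c} {r = r}
  ¬ta ¬tb (sa , fa) (sb , fb) rv@(m , m∈a , m̄∈b , _ , spec) =
  (λ _ → sat-r) , λ l∈c → Resolvent-sound rv (fa l∈c) (fb l∈c)
  where
  falsified⇒⊆c : (¬ d ≈ c → Sat α d) → ¬ Sat α d → d ⊆ c
  falsified⇒⊆c sd ¬sd = ¬¬≈⇒⊆ (¬sd ∘ sd)
  -- A premise falsified by α is c, so its pivot literal lies in c, and the flip towards it
  -- satisfies the other premise by a literal of the resolvent that α itself satisfies.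
  sat-r : Sat α r
  sat-r with sat? α a | sat? α b
  ... | no ¬sa | _ = flip-sat-resolvent ¬tb m̄∈b (λ k∈b k≢m̄ → proj₂ (spec _) (inj₂ (k∈b , k≢m̄)))
      (subst (λ l → Sat (α [ l ]) b) (sym (comp-involutive m)) (fb (falsified⇒⊆c sa ¬sa m∈a)))
  ... | yes _ | no ¬sb = flip-sat-resolvent ¬ta m∈a (λ k∈a k≢m → proj₂ (spec _) (inj₁ (k∈a , k≢m)))
      (fa (falsified⇒⊆c sb ¬sb m̄∈b))
  ... | yes sa′ | yes sb′ = Resolvent-sound rv sa′ sb′

ResCn-FlipInvariant : (∀ {d} → H d → ¬ Taut d) → (∀ {d} → H d → FlipInvariant α c d)
  → ResCn H d → FlipInvariant α c d
ResCn-FlipInvariant _ inv (base d∈H) = inv d∈H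
ResCn-FlipInvariant ¬t inv (res a∈ b∈ rv) =
  FlipInvariant-resolvent (ResCn-¬Taut ¬t a∈) (ResCn-¬Taut ¬t b∈)
    (ResCn-FlipInvariant ¬t inv a∈) (ResCn-FlipInvariant ¬t inv b∈) rv

Superredundant⇒Sat : Superredundant H c → (∀ {d} → H d → ¬ Taut d)
  → (∀ {d} → H d → FlipInvariant α c d) → Sat α c
Superredundant⇒Sat sr ¬t inv = sr _ λ _ (d∈ , d≉c) → proj₁ (ResCn-FlipInvariant ¬t inv d∈) d≉c

SatFlips-agreeOff : AgreeOff x β α → NotOccurs x e → SatFlips α c e → SatFlips β c e
SatFlips-agreeOff ag x∉e f l∈c = Sat-agreeOff (AgreeOff-update ag) x∉e (f l∈c)

FlipInvariant-agreeOff : AgreeOff x β α → NotOccurs x e → FlipInvariant α c e → FlipInvariant β c e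
FlipInvariant-agreeOff ag x∉e (s , f) = Sat-agreeOff ag x∉e ∘ s , SatFlips-agreeOff ag x∉e f

flip-witness : Sat α p → ¬ Sat (α [ l ]) p → comp l ∈ p
flip-witness {l = l} s ¬s′ with find s
... | n , n∈p , sn with n ≟ₗ comp l
...   | yes refl = n∈p
...   | no n≢l̄ = ⊥-elim (¬s′ (lose n∈p (SatLit-update⁺ sn n≢l̄)))

falsified-resolvent : ¬ Sat α c → ¬ Taut p → l ∈ c → Sat α p → ¬ Sat (α [ l ]) p
  → Resolvent c p (resolvent c l p) × ¬ Sat α (resolvent c l p) × l ∉ resolvent c l p
falsified-resolvent {α = α} {c = c} {p = p} {l = l} α⊭c ¬tp l∈c s ¬s′ =
  Resolvent-resolvent l∈c l̄∈p (¬sat ∘ Taut⇒Sat) , ¬sat , l∉r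
  where
  l̄∈p : comp l ∈ p
  l̄∈p = flip-witness s ¬s′
  ¬sat : ¬ Sat α (resolvent c l p)
  ¬sat s-r with find s-r
  ... | k , k∈r , sk with ∈-resolvent⁻ k∈r
  ...   | inj₁ (k∈c , _) = α⊭c (lose k∈c sk)
  ...   | inj₂ (k∈p , k≢l̄) = ¬s′ (lose k∈p (SatLit-update⁺ sk k≢l̄))
  l∉r : l ∉ resolvent c l p
  l∉r l∈r with ∈-resolvent⁻ {a = c} {b = p} l∈r
  ... | inj₁ (_ , l≢l) = l≢l refl
  ... | inj₂ (l∈p , _) = ¬tp (clash→taut l∈p l̄∈p)

flips-of-irresolvable : ¬ Sat α c → ¬ Taut p → Sat α p → ¬ Resolve c p → SatFlips α c p
flips-of-irresolvable {α = α} {p = p} α⊭c ¬tp s ¬res {l = l} l∈c with sat? (α [ l ]) p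
... | yes s′ = s′
... | no ¬s′ = ⊥-elim (¬res (_ , proj₁ (falsified-resolvent α⊭c ¬tp l∈c s ¬s′)))

FlipInvariant-base : ¬ Sat α c → (∀ d → ResCn H d × ¬ d ≈ c → Sat α d) → H c
  → ¬ Taut e → H e → FlipInvariant α c e
FlipInvariant-base {α = α} {c = c} {e = e} α⊭c hα c∈H ¬te e∈H =
  (λ e≉c → hα _ (base e∈H , e≉c)) , flips
  where
  flips : SatFlips α c e
  flips {l} l∈c with sat? (α [ l ]) e
  ... | yes s = s
  ... | no ¬s =
    let e≉c = λ e≈c → ¬s (lose (≈⇒⊇ e≈c l∈c) update-sat)
        rv , α⊭r , l∉r = falsified-resolvent α⊭c ¬te l∈c (hα _ (base e∈H , e≉c)) ¬s
    in ⊥-elim (α⊭r (hα _ (res (base c∈H) (base e∈H) rv , λ r≈c → l∉r (≈⇒⊇ r≈c l∈c))))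

SatAround : Assignment → Clause → Clause → Set
SatAround α c e = Sat α e × SatFlips α c e

SatAround⇒FlipInvariant : SatAround α c e → FlipInvariant α c e
SatAround⇒FlipInvariant (s , f) = (λ _ → s) , f

SatAround-⊆ : d ⊆ e → SatAround α c d → SatAround α c e
SatAround-⊆ d⊆e (s , f) = Any-resp-⊆ d⊆e s , λ l∈c → Any-resp-⊆ d⊆e (f l∈c)

SatAround-agreeOff : AgreeOff x β α → NotOccurs x e → SatAround α c e → SatAround β c e
SatAround-agreeOff ag x∉e (s , f) = Sat-agreeOff ag x∉e s , SatFlips-agreeOff ag x∉e f

SatAround-head : var k ≡ x → NotOccurs x c → SatAround (α [ k ]) c (k ∷ e)
SatAround-head k≡x x∉c = here update-sat , λ l∈c →
  here (SatLit-update-other (λ k≡l → NotOccurs-var x∉c l∈c (trans (sym k≡l) k≡x)) update-sat)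

SatAround-++⁻ʳ : ¬ Taut (p ++ q) → ¬ Sat α p → SatAround α c (p ++ q) → SatAround α c q
SatAround-++⁻ʳ {p = p} {q = q} {α = α} {c = c} ¬t ¬sp (s , f) = sq , fq
  where
  sq : Sat α q
  sq = [ ⊥-elim ∘ ¬sp , id ] (++⁻ p s)
  fq : SatFlips α c q
  fq l∈c with ++⁻ p (f l∈c)
  ... | inj₂ s′ = s′
  ... | inj₁ s′ with Sat-update⁻ s′
  ...   | inj₂ sp = ⊥-elim (¬sp sp)
  ...   | inj₁ l∈p with find sq
  ...     | n , n∈q , sn =
    lose n∈q (SatLit-update⁺ sn λ { refl → ¬t (clash→taut (++⁺ˡ l∈p) (++⁺ʳ p n∈q)) })

split-extension : ∀ {y z} → ¬ Sat α c → var y ≡ x → var z ≡ x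
  → NotOccurs x c → NotOccurs x p → NotOccurs x q → ¬ Taut (p ++ q)
  → SatAround α c (p ++ q) → ¬ Resolve c p
  → Σ Assignment λ β → AgreeOff x β α × SatAround β c (y ∷ p) × SatAround β c (z ∷ q)
split-extension {α = α} {p = p} {q = q} {y = y} {z = z} α⊭c y≡x z≡x x∉c x∉p x∉q ¬t around ¬res
  with sat? α p
... | yes sp = α [ z ] , update-agreeOff z≡x ,
  SatAround-⊆ (xs⊆x∷xs p y)
    (SatAround-agreeOff (update-agreeOff z≡x) x∉p
      (sp , flips-of-irresolvable α⊭c (¬Taut-⊆ (xs⊆xs++ys p q) ¬t) sp ¬res)) ,
  SatAround-head z≡x x∉c
... | no ¬sp = α [ y ] , update-agreeOff y≡x , SatAround-head y≡x x∉c ,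
  SatAround-⊆ (xs⊆x∷xs q z)
    (SatAround-agreeOff (update-agreeOff y≡x) x∉q (SatAround-++⁻ʳ ¬t ¬sp around))

both-or-not : ∀ {A B : Set} → Dec A → Dec B → (A × B) ⊎ (¬ A ⊎ ¬ B)
both-or-not (yes a) (yes b) = inj₁ (a , b)
both-or-not (no ¬a) _ = inj₂ (inj₁ ¬a)
both-or-not (yes _) (no ¬b) = inj₂ (inj₂ ¬b)

module _ (F : List Clause) (x : Var) (c c1 c2 : Clause)
  (¬taut : ∀ d → d ∈F F → ¬ Taut d) (x∉F : ∀ d → d ∈F F → NotOccurs x d)
  (c∈F : c ∈F F) (c12∈F : (c1 ++ c2) ∈F F) (c≉c12 : ¬ (c ≈ (c1 ++ c2)))
  (sr : Superredundant (split F x c1 c2) c)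
  where

  x∉c12 : NotOccurs x (c1 ++ c2)
  x∉c12 = x∉F _ c12∈F

  x∉c1 : NotOccurs x c1
  x∉c1 = NotOccurs-⊆ (xs⊆xs++ys c1 c2) x∉c12

  x∉c2 : NotOccurs x c2
  x∉c2 = NotOccurs-⊆ (xs⊆ys++xs c2 c1) x∉c12

  ¬t12 : ¬ Taut (c1 ++ c2)
  ¬t12 = ¬taut _ c12∈F

  ¬taut-split : ∀ {d} → split F x c1 c2 d → ¬ Taut d
  ¬taut-split (inj₁ (d∈F , _)) = ¬taut _ d∈F
  ¬taut-split (inj₂ (inj₁ d≈)) = ¬Taut-⊆ (≈⇒⊆ d≈) (¬Taut-∷ x∉c1 (¬Taut-⊆ (xs⊆xs++ys c1 c2) ¬t12))
  ¬taut-split (inj₂ (inj₂ d≈)) = ¬Taut-⊆ (≈⇒⊆ d≈) (¬Taut-∷ x∉c2 (¬Taut-⊆ (xs⊆ys++xs c2 c1) ¬t12))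

  module _ {α} (hα : ∀ d → ResCn (toFormula F) d × ¬ d ≈ c → Sat α d) (α⊭c : ¬ Sat α c) where

    FlipInvariant-F : ∀ {d} → d ∈F F → FlipInvariant α c d
    FlipInvariant-F d∈F = FlipInvariant-base α⊭c hα c∈F (¬taut _ d∈F) d∈F

    SatAround-c12 : SatAround α c (c1 ++ c2)
    SatAround-c12 = proj₁ (FlipInvariant-F c12∈F) (c≉c12 ∘ ≈-sym) , proj₂ (FlipInvariant-F c12∈F)

    no-split-extension : ∀ β → AgreeOff x β α
      → SatAround β c (pos x ∷ c1) → SatAround β c (neg x ∷ c2) → ⊥
    no-split-extension β ag around1 around2 =
      α⊭c (Sat-agreeOff (AgreeOff-sym ag) (x∉F _ c∈F) (Superredundant⇒Sat sr ¬taut-split inv))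
      where
      inv : ∀ {d} → split F x c1 c2 d → FlipInvariant β c d
      inv (inj₁ (d∈F , _)) = FlipInvariant-agreeOff ag (x∉F _ d∈F) (FlipInvariant-F d∈F)
      inv (inj₂ (inj₁ d≈)) = SatAround⇒FlipInvariant (SatAround-⊆ (≈⇒⊇ d≈) around1)
      inv (inj₂ (inj₂ d≈)) = SatAround⇒FlipInvariant (SatAround-⊆ (≈⇒⊇ d≈) around2)

    no-counterexample : ¬ Resolve c c1 ⊎ ¬ Resolve c c2 → ⊥
    no-counterexample (inj₁ ¬r1) =
      let β , ag , around1 , around2 =
            split-extension α⊭c refl refl (x∉F _ c∈F) x∉c1 x∉c2 ¬t12 SatAround-c12 ¬r1
      in no-split-extension β ag around1 around2
    no-counterexample (inj₂ ¬r2) =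
      let β , ag , around2 , around1 =
            split-extension α⊭c refl refl (x∉F _ c∈F) x∉c2 x∉c1 (¬Taut-⊆ (++-comm c2 c1) ¬t12)
              (SatAround-⊆ (++-comm c1 c2) SatAround-c12) ¬r2
      in no-split-extension β ag around1 around2

  irresolvable⇒superredundant : ¬ Resolve c c1 ⊎ ¬ Resolve c c2 → Superredundant (toFormula F) c
  irresolvable⇒superredundant ¬res α hα with sat? α c
  ... | yes s = s
  ... | no α⊭c = ⊥-elim (no-counterexample hα α⊭c ¬res)

lemma17 : (F : List Clause) (x : Var) (c c1 c2 : Clause)
    → (∀ d → d ∈F F → ¬ Taut d)
    → (∀ d → d ∈F F → NotOccurs x d)
    → c ∈F F
    → (c1 ++ c2) ∈F F
    → ¬ (c ≈ (c1 ++ c2))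
    → Superredundant (split F x c1 c2) c
    → (Resolve c c1 × Resolve c c2) ⊎ Superredundant (toFormula F) c
lemma17 F x c c1 c2 ¬taut x∉F c∈F c12∈F c≉c12 sr =
  Sum.map₂ (irresolvable⇒superredundant F x c c1 c2 ¬taut x∉F c∈F c12∈F c≉c12 sr)
    (both-or-not (resolve? c c1) (resolve? c c2))
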